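{- Let $P$ be a dynamic path (as in the context), let $x$ be a sink location with $x>x_0$, and let $x_r$ be the rightmost vertex with $x_r<x$ (so $r<n$ or $x$ lies beyond no further edge; edges $e_1,\dots,e_{r+1}$ are the ones used by left evacuation). Let $P'$ be the same dynamic path but with the capacity of $e_i$ replaced by $c'_i=\min_{i\le j\le r+1}c_j$ for $i=1,\dots,r+1$. Then $\Theta_L(P,x)=\Theta_L(P',x)$.
   Context: A dynamic path $P$ consists of real points (vertices) $x_0<\dots<x_n$, edges $e_i=(x_{i-1},x_i)$ for $1\le i\le n$, a constant $\tau>0$ (time to travel unit distance) with every $|x_i-x_j|\tau$ an integer, nonnegative integer weights $w_i$ (people at $x_i$) and positive integer capacities $c_i$ of $e_i$. Discrete evacuation model with sink $x\in(x_0,x_n]$: everyone moves toward $x$; time is discrete; at each vertex people wait in a FIFO queue to enter the next edge toward $x$; at each integer time step at most $c_i$ people may enter $e_i$, entering as soon as capacity and the queue permit; distance $d$ takes time $d\tau$. $\Theta_L(P,x)$ is the time at which all people starting on vertices strictly left of $x$ have reached $x$.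
   Formalization: The sink location x enters only through its offset from $x_r$ scaled by τ, which ranges over the rationals rather than the reals. -}

module Defs where

open import Data.Nat using (ℕ; zero; suc; _+_; _∸_; _⊓_; _≤_; _<_; _≤?_; _<?_)
open import Data.Fin using (Fin; toℕ; fromℕ<)
open import Data.Product using (Σ; _×_)
open import Data.Sum using (_⊎_)
open import Data.Integer using (+_)
open import Data.Rational as ℚ using (ℚ; 0ℚ)
open import Relation.Nullary using (yes; no)
open import Relation.Binary.PropositionalEquality using (_≡_; _≢_)

-- Positions and τ enter the model only through the (integer) travel
-- times  len i = (x_{i+1} - x_i)·τ  of the edges; Fin-index i : Fin n
-- stands for the paper's edge e_{i+1} = (x_i , x_{i+1}).
--   w i : people at vertex x_i   (i : Fin (suc n))
--   c i : capacity of e_{i+1}    (i : Fin n)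

record DynPath (n : ℕ) : Set where
  constructor mkPath
  field
    len : Fin n → ℕ
    w   : Fin (suc n) → ℕ
    c   : Fin n → ℕ

open DynPath public

-- Standing assumptions: x_i < x_{i+1} and τ > 0 (so len i ≥ 1), c_i ≥ 1.
Valid : ∀ {n} → DynPath n → Set
Valid {n} P = ((i : Fin n) → 1 ≤ len P i) × ((i : Fin n) → 1 ≤ c P i)

at : ∀ {m} → (Fin m → ℕ) → ℕ → ℕ
at {m} f k with k <? m
... | yes p = f (fromℕ< p)
... | no  _ = 0

cumul : (ℕ → ℕ) → ℕ → ℕ
cumul f zero    = f zero
cumul f (suc T) = cumul f T + f (suc T)

minSeg : (ℕ → ℕ) → ℕ → ℕ → ℕ
minSeg f i zero    = f i
minSeg f i (suc d) = f i ⊓ minSeg f (suc i) d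

-- Discrete dynamics (counts suffice: all people are interchangeable).

initial : ℕ → ℕ → ℕ
initial a zero    = a
initial a (suc _) = 0

shift : ℕ → (ℕ → ℕ) → ℕ → ℕ
shift d f s with d ≤? s
... | yes _ = f (s ∸ d)
... | no  _ = 0

-- FIFO queue at a vertex in front of an edge of capacity c, with
-- arrival sequence a.  qlen c a s = number of people waiting at time s
-- (those left over from time s-1 plus those arriving at time s),
-- dep c a s = number entering the edge at time s (as many as possible).
qlen : ℕ → (ℕ → ℕ) → ℕ → ℕ
qlen c a zero    = a zero
qlen c a (suc s) = (qlen c a s ∸ c) + a (suc s)

dep : ℕ → (ℕ → ℕ) → ℕ → ℕ
dep c a s = c ⊓ qlen c a s

-- Left evacuation (everybody moves right, towards the sink).
-- arr P k s = number of people arriving at / present at vertex x_k at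
-- time s (initial people at time 0, plus those that entered e_k at
-- time s - len(e_k)).
arr : ∀ {n} → DynPath n → ℕ → ℕ → ℕ
arr P zero    s = initial (at (w P) zero) s
arr P (suc k) s =
  initial (at (w P) (suc k)) s
    + shift (at (len P) k) (dep (at (c P) k) (arr P k)) s

-- Sink x with x_r < x ≤ x_{r+1}  (r : Fin n), δ = (x - x_r)·τ,
-- so 0 < δ ≤ len r.  People of x_0 … x_r evacuate to x through
-- e_1 … e_{r+1}; entries into e_{r+1} (from x_r) at time s:
entries : ∀ {n} → DynPath n → Fin n → ℕ → ℕ
entries P r = dep (c P r) (arr P (toℕ r))

leftWeight : ∀ {n} → DynPath n → Fin n → ℕ
leftWeight P r = cumul (at (w P)) (toℕ r)

toℚ : ℕ → ℚ
toℚ m = + m ℚ./ 1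

-- θ = Θ_L(P, x): the time at which the last person from the left
-- arrives at x (0 if there is nobody).  Someone entering e_{r+1} at
-- integer time T arrives at x at time T + δ.
IsThetaL : ∀ {n} → DynPath n → Fin n → ℚ → ℚ → Set
IsThetaL P r δ θ =
  (leftWeight P r ≡ 0 × θ ≡ 0ℚ)
  ⊎ Σ ℕ (λ T → (leftWeight P r ≢ 0)
              × (cumul (entries P r) T ≡ leftWeight P r)
              × ((s : ℕ) → s < T → cumul (entries P r) s < leftWeight P r)
              × (θ ≡ toℚ T ℚ.+ δ))

-- P' : capacities of e_1 … e_{r+1} replaced by c'_i = min_{i≤j≤r+1} c_j
-- (0-based: for i ≤ r, c' i = min_{i ≤ j ≤ r} c j); others unchanged.

capMin : ∀ {n} → (Fin n → ℕ) → Fin n → Fin n → ℕ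
capMin c r i with toℕ i ≤? toℕ r
... | yes _ = minSeg (at c) (toℕ i) (toℕ r ∸ toℕ i)
... | no  _ = c i

reduceCaps : ∀ {n} → DynPath n → Fin n → DynPath n
reduceCaps P r = mkPath (len P) (w P) (capMin (c P) r)

-- In cumulative form a FIFO queue of capacity c turns arrivals A into departures
-- D s = min (A s , D (s-1) + c).  Two such queues in series act as one queue of the
-- smaller capacity, and a queue of capacity b does not notice whether its input was
-- already throttled to b upstream before being merged with the local people.  By
-- induction along the path, the departures of P' from x_k are those of P's arrivals at
-- x_k through a single queue of capacity c'_k.  At x_r that capacity is c_{r+1}, so the
-- entries into e_{r+1}, and hence the evacuation times, are the same in P and P'.

module Submission where

open import Defs
open import Data.Nat using (ℕ; zero; suc; _+_; _∸_; _⊓_; _≤_; _<_; _≤?_; _<?_; z≤n; s<s; _≟_)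
open import Data.Nat.Properties
open import Data.Nat.Induction using (<-rec)
open import Data.Fin using (Fin; toℕ; fromℕ<)
open import Data.Fin.Properties using (toℕ<n; fromℕ<-toℕ; toℕ-fromℕ<)
open import Data.Product using (Σ; _×_; _,_; ∃; proj₂)
open import Data.Sum using (inj₁; inj₂)
open import Data.Rational as ℚ using (ℚ; 0ℚ)
open import Relation.Nullary using (yes; no; ¬_)
open import Relation.Nullary.Negation using (contradiction)
open import Relation.Unary using (Pred; Decidable)
open import Relation.Binary.PropositionalEquality

IsLeast : ∀ {p} → Pred ℕ p → ℕ → Set p
IsLeast Q T = Q T × (∀ s → s < T → ¬ Q s)

least-witness : ∀ {p} {Q : Pred ℕ p} → Decidable Q → ∀ {S} → Q S → ∃ (IsLeast Q)
least-witness {Q = Q} Q? {S} = <-rec (λ S → Q S → ∃ (IsLeast Q)) search S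
  where
  search : ∀ S → (∀ {s} → s < S → Q s → ∃ (IsLeast Q)) → Q S → ∃ (IsLeast Q)
  search S earlier QS with anyUpTo? Q? S
  ... | yes (s , s<S , Qs) = earlier s<S Qs
  ... | no none            = S , QS , λ s s<S Qs → none (s , s<S , Qs)

cumul-initial : ∀ a s → cumul (initial a) s ≡ a
cumul-initial a zero    = refl
cumul-initial a (suc s) = trans (+-identityʳ _) (cumul-initial a s)

cumul-initial+ : ∀ a g s → cumul (λ t → initial a t + g t) s ≡ a + cumul g s
cumul-initial+ a g zero    = refl
cumul-initial+ a g (suc s) = trans (cong (_+ g (suc s)) (cumul-initial+ a g s)) (+-assoc a _ _)

shift-< : ∀ L f s → s < L → shift L f s ≡ 0
shift-< L f s s<L with L ≤? s
... | yes L≤s = contradiction L≤s (<⇒≱ s<L)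
... | no _    = refl

shift-+ : ∀ L f t → shift L f (t + L) ≡ f t
shift-+ L f t with L ≤? t + L
... | yes _   = cong f (m+n∸n≡m t L)
... | no L≰t+L = contradiction (m≤n+m L t) L≰t+L

shift-cong : ∀ L {f g} → (∀ s → f s ≡ g s) → ∀ s → shift L f s ≡ shift L g s
shift-cong L f≡g s with L ≤? s
... | yes _ = f≡g (s ∸ L)
... | no _  = refl

shift-≤ : ∀ L {f W} → (∀ s → f s ≤ W) → ∀ s → shift L f s ≤ W
shift-≤ L f≤W s with L ≤? s
... | yes _ = f≤W (s ∸ L)
... | no _  = z≤n

shift-unique : ∀ L {F g} → (∀ s → s < L → F s ≡ 0) → (∀ t → F (t + L) ≡ g t) →
               ∀ s → F s ≡ shift L g s
shift-unique L {F} early late s with L ≤? s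
... | no L≰s = early s (≰⇒> L≰s)
... | yes L≤s = trans (cong F (sym (m∸n+n≡m L≤s))) (late (s ∸ L))

cumul-shift-< : ∀ L f s → s < L → cumul (shift L f) s ≡ 0
cumul-shift-< L f zero    s<L = shift-< L f 0 s<L
cumul-shift-< L f (suc s) s<L =
  cong₂ _+_ (cumul-shift-< L f s (<-trans (n<1+n s) s<L)) (shift-< L f (suc s) s<L)

cumul-shift-+ : ∀ L f t → cumul (shift L f) (t + L) ≡ cumul f t
cumul-shift-+ zero     f zero    = shift-+ 0 f 0
cumul-shift-+ (suc L′) f zero    = cong₂ _+_ (cumul-shift-< (suc L′) f L′ (n<1+n L′)) (shift-+ (suc L′) f 0)
cumul-shift-+ L        f (suc t) = cong₂ _+_ (cumul-shift-+ L f t) (shift-+ L f (suc t))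

cumul-shift : ∀ L f s → cumul (shift L f) s ≡ shift L (cumul f) s
cumul-shift L f = shift-unique L (cumul-shift-< L f) (cumul-shift-+ L f)

at-toℕ : ∀ {m} (f : Fin m → ℕ) (i : Fin m) → at f (toℕ i) ≡ f i
at-toℕ {m} f i with toℕ i <? m
... | yes i<m = cong f (fromℕ<-toℕ i i<m)
... | no i≮m  = contradiction (toℕ<n i) i≮m

at-pos : ∀ {m} (f : Fin m → ℕ) → (∀ i → 1 ≤ f i) → ∀ k → k < m → 1 ≤ at f k
at-pos {m} f f-pos k k<m with k <? m
... | yes k<m′ = f-pos (fromℕ< k<m′)
... | no k≮m   = contradiction k<m k≮m

outflow : ℕ → (ℕ → ℕ) → ℕ → ℕ
outflow c A zero    = A zero ⊓ c
outflow c A (suc s) = A (suc s) ⊓ (outflow c A s + c)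

departed+waiting≡arrived : ∀ c a s → cumul (dep c a) s + (qlen c a s ∸ c) ≡ cumul a s
departed+queued≡arrived : ∀ c a s → cumul (dep c a) s + qlen c a (suc s) ≡ cumul a (suc s)

departed+waiting≡arrived c a zero    = m⊓n+n∸m≡n c (a 0)
departed+waiting≡arrived c a (suc s) = begin
    D + c ⊓ q + (q ∸ c)    ≡⟨ +-assoc D (c ⊓ q) (q ∸ c) ⟩
    D + (c ⊓ q + (q ∸ c))  ≡⟨ cong (D +_) (m⊓n+n∸m≡n c q) ⟩
    D + q                  ≡⟨ departed+queued≡arrived c a s ⟩
    cumul a (suc s)        ∎
  where
  open ≡-Reasoning
  D q : ℕ
  D = cumul (dep c a) s
  q = qlen c a (suc s)

departed+queued≡arrived c a s =
  trans (sym (+-assoc (cumul (dep c a) s) _ (a (suc s))))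
        (cong (_+ a (suc s)) (departed+waiting≡arrived c a s))

cumul-dep≡outflow : ∀ c a s → cumul (dep c a) s ≡ outflow c (cumul a) s
cumul-dep≡outflow c a zero    = ⊓-comm c (a 0)
cumul-dep≡outflow c a (suc s) = begin
    D + c ⊓ q                      ≡⟨ +-distribˡ-⊓ D c q ⟩
    (D + c) ⊓ (D + q)              ≡⟨ cong ((D + c) ⊓_) (departed+queued≡arrived c a s) ⟩
    (D + c) ⊓ cumul a (suc s)      ≡⟨ ⊓-comm (D + c) _ ⟩
    cumul a (suc s) ⊓ (D + c)      ≡⟨ cong (λ x → cumul a (suc s) ⊓ (x + c)) (cumul-dep≡outflow c a s) ⟩
    outflow c (cumul a) (suc s)    ∎
  where
  open ≡-Reasoning
  D q : ℕ
  D = cumul (dep c a) s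
  q = qlen c a (suc s)

outflow≤ : ∀ c A s → outflow c A s ≤ A s
outflow≤ c A zero    = m⊓n≤m _ _
outflow≤ c A (suc s) = m⊓n≤m _ _

outflow-mono : ∀ c {A B} → (∀ s → A s ≤ B s) → ∀ s → outflow c A s ≤ outflow c B s
outflow-mono c A≤B zero    = ⊓-monoˡ-≤ c (A≤B 0)
outflow-mono c A≤B (suc s) = ⊓-mono-≤ (A≤B (suc s)) (+-monoˡ-≤ c (outflow-mono c A≤B s))

outflow-cong : ∀ c {A B} → (∀ s → A s ≡ B s) → ∀ s → outflow c A s ≡ outflow c B s
outflow-cong c A≡B zero    = cong (_⊓ c) (A≡B 0)
outflow-cong c A≡B (suc s) = cong₂ _⊓_ (A≡B (suc s)) (cong (_+ c) (outflow-cong c A≡B s))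

Rate≤ : ℕ → (ℕ → ℕ) → Set
Rate≤ a F = F 0 ≤ a × (∀ s → F (suc s) ≤ F s + a)

outflow-rate≤capacity : ∀ c A → Rate≤ c (outflow c A)
outflow-rate≤capacity c A = m⊓n≤n _ _ , λ _ → m⊓n≤n _ _

⊓-≤-+ : ∀ {x y p q} a → x ≤ p + a → y ≤ q + a → x ⊓ y ≤ p ⊓ q + a
⊓-≤-+ {x} {y} {p} {q} a x≤ y≤ = subst (x ⊓ y ≤_) (sym (+-distribʳ-⊓ a p q)) (⊓-mono-≤ x≤ y≤)

+-right-comm : ∀ x y z → x + y + z ≡ x + z + y
+-right-comm x y z = trans (+-assoc x y z) (trans (cong (x +_) (+-comm y z)) (sym (+-assoc x z y)))

outflow-preserves-rate : ∀ {a F} b → Rate≤ a F → Rate≤ a (outflow b F)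
outflow-preserves-rate {a} {F} b (F0≤a , F-step) = ≤-trans (m⊓n≤m _ _) F0≤a , step
  where
  step : ∀ s → outflow b F (suc s) ≤ outflow b F s + a
  step zero    = ⊓-≤-+ a (F-step 0)
    (≤-trans (+-monoˡ-≤ b (≤-trans (m⊓n≤m _ _) F0≤a)) (≤-reflexive (+-comm a b)))
  step (suc s) = ⊓-≤-+ a (F-step (suc s))
    (≤-trans (+-monoˡ-≤ b (step s)) (≤-reflexive (+-right-comm (outflow b F s) a b)))

-- G ≤ H needs that G = outflow b (outflow a A) still has rate at most a.
outflow-∘ : ∀ a b A s → outflow b (outflow a A) s ≡ outflow (a ⊓ b) A s
outflow-∘ a b A zero    = ⊓-assoc (A 0) a b
outflow-∘ a b A (suc s) = ≤-antisym G≤H H≤G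
  where
  F G H : ℕ → ℕ
  F = outflow a A
  G = outflow b F
  H = outflow (a ⊓ b) A
  G≡H : G s ≡ H s
  G≡H = outflow-∘ a b A s
  G-rate : G (suc s) ≤ G s + a
  G-rate = proj₂ (outflow-preserves-rate b (outflow-rate≤capacity a A)) s
  H+a⊓b : H s + a ⊓ b ≡ (H s + a) ⊓ (H s + b)
  H+a⊓b = +-distribˡ-⊓ (H s) a b
  G≤H : G (suc s) ≤ H (suc s)
  G≤H = ⊓-glb (≤-trans (m⊓n≤m _ _) (outflow≤ a A (suc s)))
          (subst (G (suc s) ≤_) (sym H+a⊓b)
            (⊓-glb (subst (λ x → G (suc s) ≤ x + a) G≡H G-rate)
                   (subst (λ x → G (suc s) ≤ x + b) G≡H (m⊓n≤n _ _))))
  H≤G : H (suc s) ≤ G (suc s)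
  H≤G = ⊓-glb
    (⊓-glb (m⊓n≤m _ _) (≤-trans (m⊓n≤n _ _) (subst (_≤ F s + a) (sym H+a⊓b)
      (≤-trans (m⊓n≤m _ _) (+-monoˡ-≤ a (subst (_≤ F s) G≡H (outflow≤ b F s)))))))
    (≤-trans (m⊓n≤n _ _) (subst (_≤ G s + b) (sym H+a⊓b)
      (≤-trans (m⊓n≤n _ _) (≤-reflexive (cong (_+ b) (sym G≡H))))))

outflow-idem : ∀ c A s → outflow c (outflow c A) s ≡ outflow c A s
outflow-idem c A s = trans (outflow-∘ c c A s) (cong (λ x → outflow x A s) (⊓-idem c))

outflow-shift-< : ∀ c L A s → s < L → outflow c (shift L A) s ≡ 0
outflow-shift-< c L A s s<L = n≤0⇒n≡0 (subst (outflow c (shift L A) s ≤_) (shift-< L A s s<L) (outflow≤ c _ s))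

outflow-shift-+ : ∀ c L A t → outflow c (shift L A) (t + L) ≡ outflow c A t
outflow-shift-+ c zero     A zero    = cong (_⊓ c) (shift-+ 0 A 0)
outflow-shift-+ c (suc L′) A zero    =
  cong₂ _⊓_ (shift-+ (suc L′) A 0) (cong (_+ c) (outflow-shift-< c (suc L′) A L′ (n<1+n L′)))
outflow-shift-+ c L        A (suc t) = cong₂ _⊓_ (shift-+ L A (suc t)) (cong (_+ c) (outflow-shift-+ c L A t))

outflow-shift : ∀ c L A s → outflow c (shift L A) s ≡ shift L (outflow c A) s
outflow-shift c L A = shift-unique L (outflow-shift-< c L A) (outflow-shift-+ c L A)

outflow-+ : ∀ c w A s → outflow c (λ t → w + A t) s ≤ w + outflow c A s
outflow-+ c w A zero    =
  subst ((w + A 0) ⊓ c ≤_) (sym (+-distribˡ-⊓ w (A 0) c)) (⊓-monoʳ-≤ (w + A 0) (m≤n+m c w))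
outflow-+ c w A (suc s) =
  subst (outflow c (λ t → w + A t) (suc s) ≤_) (sym (+-distribˡ-⊓ w (A (suc s)) _))
    (⊓-monoʳ-≤ (w + A (suc s)) (subst (outflow c (λ t → w + A t) s + c ≤_) (+-assoc w _ c)
      (+-monoˡ-≤ c (outflow-+ c w A s))))

outflow-sandwich : ∀ c {G H} → (∀ s → outflow c G s ≤ H s) → (∀ s → H s ≤ G s) →
                   ∀ s → outflow c H s ≡ outflow c G s
outflow-sandwich c {G} {H} G′≤H H≤G s = ≤-antisym (outflow-mono c H≤G s)
  (subst (_≤ outflow c H s) (outflow-idem c G s) (outflow-mono c G′≤H s))

outflow-absorb : ∀ c w A s → outflow c (λ t → w + outflow c A t) s ≡ outflow c (λ t → w + A t) s
outflow-absorb c w A = outflow-sandwich c (outflow-+ c w A) (λ t → +-monoʳ-≤ w (outflow≤ c A t))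

Reaches : ℕ → (ℕ → ℕ) → Set
Reaches W F = (∀ s → F s ≤ W) × Σ ℕ (λ S → ∀ t → F (t + S) ≡ W)

reaches-cong : ∀ {W F G} → (∀ s → F s ≡ G s) → Reaches W F → Reaches W G
reaches-cong F≡G (F≤W , S , F≡W) =
  (λ s → subst (_≤ _) (F≡G s) (F≤W s)) , S , λ t → trans (sym (F≡G (t + S))) (F≡W t)

reaches-+ : ∀ w {W F} → Reaches W F → Reaches (W + w) (λ s → w + F s)
reaches-+ w {W} {F} (F≤W , S , F≡W) =
  (λ s → subst (w + F s ≤_) (+-comm w W) (+-monoʳ-≤ w (F≤W s))) , S ,
  λ t → trans (cong (w +_) (F≡W t)) (+-comm w W)

reaches-shift : ∀ L {W F} → Reaches W F → Reaches W (shift L F)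
reaches-shift L {W} {F} (F≤W , S , F≡W) = shift-≤ L F≤W , S + L , λ t → begin
    shift L F (t + (S + L))  ≡⟨ cong (shift L F) (sym (+-assoc t S L)) ⟩
    shift L F (t + S + L)    ≡⟨ shift-+ L F (t + S) ⟩
    F (t + S)                ≡⟨ F≡W t ⟩
    W                        ∎
  where open ≡-Reasoning

-- Once the arrivals are complete at time S, the departures gain at least one per step
-- until all W have left, so they are complete by time W + S.
outflow-reaches : ∀ {c W A} → 1 ≤ c → Reaches W A → Reaches W (outflow c A)
outflow-reaches {c} {W} {A} 1≤c (A≤W , S , A≡W) =
  (λ s → ≤-trans (outflow≤ c A s) (A≤W s)) , W + S ,
  λ t → ≤-antisym (≤-trans (outflow≤ c A (t + (W + S))) (A≤W _)) (complete t)
  where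
  progress : ∀ t → t ⊓ W ≤ outflow c A (t + S)
  progress zero    = z≤n
  progress (suc t) = ⊓-glb (subst (suc t ⊓ W ≤_) (sym (A≡W (suc t))) (m⊓n≤n _ _))
    (≤-trans (⊓-monoʳ-≤ (suc t) (n≤1+n W))
      (≤-trans (s<s (progress t)) (subst (suc D ≤_) (+-comm c D) (+-monoˡ-≤ D 1≤c))))
    where
    D : ℕ
    D = outflow c A (t + S)
  complete : ∀ t → W ≤ outflow c A (t + (W + S))
  complete zero    = subst (_≤ outflow c A (W + S)) (⊓-idem W) (progress W)
  complete (suc t) = ⊓-glb
    (≤-reflexive (sym (trans (cong A (sym (+-assoc (suc t) W S))) (A≡W (suc t + W)))))
    (≤-trans (complete t) (m≤m+n _ c))

reaches-first : ∀ {W f} → Reaches W f → ∃ λ T → f T ≡ W × (∀ s → s < T → f s < W)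
reaches-first {W} {f} (f≤W , S , f≡W) with least-witness (λ t → f t ≟ W) (f≡W 0)
... | T , fT≡W , before = T , fT≡W , λ s s<T → ≤∧≢⇒< (f≤W s) (before s s<T)

arrived : ∀ {n} → DynPath n → ℕ → ℕ → ℕ
arrived P k = cumul (arr P k)

departed : ∀ {n} → DynPath n → ℕ → ℕ → ℕ
departed P k = cumul (dep (at (c P) k) (arr P k))

departed≡outflow : ∀ {n} (P : DynPath n) k s → departed P k s ≡ outflow (at (c P) k) (arrived P k) s
departed≡outflow P k = cumul-dep≡outflow (at (c P) k) (arr P k)

arrived-zero : ∀ {n} (P : DynPath n) s → arrived P 0 s ≡ at (w P) 0
arrived-zero P = cumul-initial (at (w P) 0)

arrived-suc : ∀ {n} (P : DynPath n) k s →
              arrived P (suc k) s ≡ at (w P) (suc k) + shift (at (len P) k) (departed P k) s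
arrived-suc P k s = trans (cumul-initial+ (at (w P) (suc k)) _ s)
  (cong (at (w P) (suc k) +_) (cumul-shift (at (len P) k) _ s))

cumul-entries : ∀ {n} (P : DynPath n) r s → cumul (entries P r) s ≡ departed P (toℕ r) s
cumul-entries P r s = cong (λ x → cumul (dep x (arr P (toℕ r))) s) (sym (at-toℕ (c P) r))

arrived-reaches : ∀ {n} (P : DynPath n) → (∀ i → 1 ≤ c P i) →
                  ∀ k → k ≤ n → Reaches (cumul (at (w P)) k) (arrived P k)
departed-reaches : ∀ {n} (P : DynPath n) → (∀ i → 1 ≤ c P i) →
                   ∀ k → k < n → Reaches (cumul (at (w P)) k) (departed P k)

arrived-reaches P c-pos zero    _   =
  reaches-cong (λ s → sym (arrived-zero P s)) ((λ _ → ≤-refl) , 0 , λ _ → refl)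
arrived-reaches P c-pos (suc k) k<n =
  reaches-cong (λ s → sym (arrived-suc P k s))
    (reaches-+ (at (w P) (suc k)) (reaches-shift (at (len P) k) (departed-reaches P c-pos k k<n)))

departed-reaches P c-pos k k<n =
  reaches-cong (λ s → sym (departed≡outflow P k s))
    (outflow-reaches (at-pos (c P) c-pos k k<n) (arrived-reaches P c-pos k (<⇒≤ k<n)))

capMin-at : ∀ {n} (f : Fin n → ℕ) (r : Fin n) k → k ≤ toℕ r →
            at (capMin f r) k ≡ minSeg (at f) k (toℕ r ∸ k)
capMin-at {n} f r k k≤r with k <? n
... | no k≮n = contradiction (≤-<-trans k≤r (toℕ<n r)) k≮n
... | yes k<n with toℕ (fromℕ< k<n) ≤? toℕ r | toℕ-fromℕ< k<n
...   | yes _   | eq rewrite eq = refl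
...   | no k≰r  | eq = contradiction (subst (_≤ toℕ r) (sym eq) k≤r) k≰r

capMin-step : ∀ {n} (f : Fin n → ℕ) (r : Fin n) k → k < toℕ r →
              at (capMin f r) k ≡ at f k ⊓ at (capMin f r) (suc k)
capMin-step f r k k<r = begin
    at (capMin f r) k                                  ≡⟨ capMin-at f r k (<⇒≤ k<r) ⟩
    minSeg (at f) k (toℕ r ∸ k)                        ≡⟨ cong (minSeg (at f) k) (+-∸-assoc 1 k<r) ⟩
    at f k ⊓ minSeg (at f) (suc k) (toℕ r ∸ suc k)     ≡⟨ cong (at f k ⊓_) (sym (capMin-at f r (suc k) k<r)) ⟩
    at f k ⊓ at (capMin f r) (suc k)                   ∎
  where open ≡-Reasoning

capMin-last : ∀ {n} (f : Fin n → ℕ) (r : Fin n) → at (capMin f r) (toℕ r) ≡ at f (toℕ r)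
capMin-last f r = trans (capMin-at f r (toℕ r) ≤-refl) (cong (minSeg (at f) (toℕ r)) (n∸n≡0 (toℕ r)))

departed-reduceCaps : ∀ {n} (P : DynPath n) r k → k ≤ toℕ r → ∀ s →
                      departed (reduceCaps P r) k s ≡ outflow (at (capMin (c P) r) k) (arrived P k) s
departed-reduceCaps P r zero    _   s = departed≡outflow (reduceCaps P r) 0 s
departed-reduceCaps P r (suc k) k<r s = begin
    departed P′ (suc k) s
  ≡⟨ departed≡outflow P′ (suc k) s ⟩
    outflow c′₁ (arrived P′ (suc k)) s
  ≡⟨ outflow-cong c′₁ arrivals-throttled s ⟩
    outflow c′₁ (λ t → w₁ + outflow c′₁ (shift L (departed P k)) t) s
  ≡⟨ outflow-absorb c′₁ w₁ (shift L (departed P k)) s ⟩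
    outflow c′₁ (λ t → w₁ + shift L (departed P k) t) s
  ≡⟨ outflow-cong c′₁ (λ t → sym (arrived-suc P k t)) s ⟩
    outflow c′₁ (arrived P (suc k)) s
  ∎
  where
  open ≡-Reasoning
  P′ : DynPath _
  P′ = reduceCaps P r
  c′₁ w₁ L : ℕ
  c′₁ = at (capMin (c P) r) (suc k)
  w₁ = at (w P) (suc k)
  L = at (len P) k
  departed-throttled : ∀ u → departed P′ k u ≡ outflow c′₁ (departed P k) u
  departed-throttled u = begin
      departed P′ k u                                       ≡⟨ departed-reduceCaps P r k (<⇒≤ k<r) u ⟩
      outflow (at (capMin (c P) r) k) (arrived P k) u       ≡⟨ cong (λ x → outflow x (arrived P k) u) (capMin-step (c P) r k k<r) ⟩
      outflow (at (c P) k ⊓ c′₁) (arrived P k) u            ≡⟨ sym (outflow-∘ (at (c P) k) c′₁ (arrived P k) u) ⟩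
      outflow c′₁ (outflow (at (c P) k) (arrived P k)) u    ≡⟨ sym (outflow-cong c′₁ (departed≡outflow P k) u) ⟩
      outflow c′₁ (departed P k) u                          ∎
  arrivals-throttled : ∀ t → arrived P′ (suc k) t ≡ w₁ + outflow c′₁ (shift L (departed P k)) t
  arrivals-throttled t = begin
      arrived P′ (suc k) t                              ≡⟨ arrived-suc P′ k t ⟩
      w₁ + shift L (departed P′ k) t                    ≡⟨ cong (w₁ +_) (shift-cong L departed-throttled t) ⟩
      w₁ + shift L (outflow c′₁ (departed P k)) t       ≡⟨ cong (w₁ +_) (sym (outflow-shift c′₁ L (departed P k) t)) ⟩
      w₁ + outflow c′₁ (shift L (departed P k)) t       ∎

entries-reduceCaps : ∀ {n} (P : DynPath n) r s → cumul (entries (reduceCaps P r) r) s ≡ cumul (entries P r) s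
entries-reduceCaps P r s = begin
    cumul (entries (reduceCaps P r) r) s                   ≡⟨ cumul-entries (reduceCaps P r) r s ⟩
    departed (reduceCaps P r) R s                          ≡⟨ departed-reduceCaps P r R ≤-refl s ⟩
    outflow (at (capMin (c P) r) R) (arrived P R) s        ≡⟨ cong (λ x → outflow x (arrived P R) s) (capMin-last (c P) r) ⟩
    outflow (at (c P) R) (arrived P R) s                   ≡⟨ sym (departed≡outflow P R s) ⟩
    departed P R s                                         ≡⟨ sym (cumul-entries P r s) ⟩
    cumul (entries P r) s                                  ∎
  where
  open ≡-Reasoning
  R : ℕ
  R = toℕ r

IsThetaL-cong : ∀ {m n} {P : DynPath m} {Q : DynPath n} {r r′ δ θ} →
                leftWeight P r ≡ leftWeight Q r′ →
                (∀ s → cumul (entries P r) s ≡ cumul (entries Q r′) s) →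
                IsThetaL P r δ θ → IsThetaL Q r′ δ θ
IsThetaL-cong W≡ E≡ (inj₁ (W≡0 , θ≡0)) = inj₁ (trans (sym W≡) W≡0 , θ≡0)
IsThetaL-cong W≡ E≡ (inj₂ (T , W≢0 , done , before , θ≡)) =
  inj₂ (T , (λ W≡0 → W≢0 (trans W≡ W≡0)) , trans (sym (E≡ T)) (trans done W≡) ,
        (λ s s<T → subst₂ _<_ (E≡ s) W≡ (before s s<T)) , θ≡)

thetaL-exists : ∀ {n} (P : DynPath n) → (∀ i → 1 ≤ c P i) → ∀ r δ → Σ ℚ (IsThetaL P r δ)
thetaL-exists P c-pos r δ with leftWeight P r ≟ 0
... | yes W≡0 = 0ℚ , inj₁ (W≡0 , refl)
... | no W≢0 with reaches-first (reaches-cong (λ s → sym (cumul-entries P r s))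
                                   (departed-reaches P c-pos (toℕ r) (toℕ<n r)))
...   | T , done , before = toℚ T ℚ.+ δ , inj₂ (T , W≢0 , done , before , refl)

corollary1 : {n : ℕ} (P : DynPath n) → Valid P →
             (r : Fin n) (δ : ℚ) → 0ℚ ℚ.< δ → δ ℚ.≤ toℚ (len P r) →
             Σ ℚ (λ θ → IsThetaL P r δ θ × IsThetaL (reduceCaps P r) r δ θ)
corollary1 P (_ , c-pos) r δ _ _ with thetaL-exists P c-pos r δ
... | θ , isθ = θ , isθ ,
  IsThetaL-cong {P = P} {reduceCaps P r} {r} {r} refl (λ s → sym (entries-reduceCaps P r s)) isθ
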